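{- Let $A=T[a_0,\ldots,a_{n-1}]$ be an $n\times n$ real symmetric Toeplitz matrix, and let $C_1,\ldots,C_k$ be the components of its weighted Toeplitz graph $G(A)$, indexed so that $M(C_1)<M(C_2)<\cdots<M(C_k)$, where $M(C_i)=\max\{v: v\in V(C_i)\}$. Then \[C_1\lesssim C_2\lesssim\cdots\lesssim C_k,\] where $G\lesssim H$ means that $G$ is isomorphic (as an edge-weighted graph) to an induced subgraph of $H$.
   Context: $[n]=\{1,\ldots,n\}$. For real numbers $a_0,\ldots,a_{n-1}$, $T[a_0,\ldots,a_{n-1}]$ denotes the $n\times n$ symmetric Toeplitz matrix whose $(i,j)$ entry is $a_{|i-j|}$. Let $S_A=\{i\in\{0,\ldots,n-1\} : a_i\neq 0\}$. The weighted Toeplitz graph $G(A)$ is the edge-weighted graph with vertex set $[n]$, edge set $\{ij: i,j\in[n],\ |i-j|\in S_A\}$, and weight $w(ij)=a_{|i-j|}$. A component is a maximal connected subgraph. -}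

module Defs where

open import Level using (Level)
open import Data.Nat using (ℕ; zero; suc)
open import Data.Fin using (Fin; zero; suc; inject₁; toℕ; _<_)
open import Data.Product using (Σ; _×_; _,_; proj₁)
open import Relation.Binary.PropositionalEquality using (_≡_)
open import Relation.Nullary using (¬_)
open import Relation.Binary.Construct.Closure.ReflexiveTransitive using (Star)
open import Function.Bundles using (_⇔_)

-- Vertices of G(A) are Fin n (vertex i ∈ Fin n stands for i+1 ∈ [n]);
-- the shift by one does not affect comparisons of maxima.

dist : ∀ {n} → Fin n → Fin n → Fin n
dist zero    zero    = zero
dist zero    (suc j) = suc j
dist (suc i) zero    = suc i
dist (suc i) (suc j) = inject₁ (dist i j)

module ToeplitzGraph {r : Level} (R : Set r) (0# : R) {n : ℕ} (a : Fin n → R) where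

  w : Fin n → Fin n → R
  w i j = a (dist i j)

  -- ij is an edge of G(A) iff |i-j| ∈ S_A, i.e. a_{|i-j|} ≠ 0
  -- (this includes loops ii when a_0 ≠ 0, as in the definition)
  Edge : Fin n → Fin n → Set r
  Edge i j = ¬ (w i j ≡ 0#)

  Reach : Fin n → Fin n → Set r
  Reach = Star Edge

  Comp : Fin n → Fin n → Set r
  Comp v = Reach v

  IsMax : (Fin n → Set r) → Fin n → Set r
  IsMax C m = C m × (∀ x → C x → ¬ (m < x))

  -- G[C] ≲ G[D]: the induced subgraph on C is isomorphic, as an edge-weighted
  -- graph, to an induced subgraph of G[D]: an injective map f : C → D such that
  -- xy is an edge iff f(x)f(y) is, with equal weights.
  Embeds : (Fin n → Set r) → (Fin n → Set r) → Set r
  Embeds C D =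
    Σ (Σ (Fin n) C → Fin n) λ f →
      (∀ x → D (f x)) ×
      (∀ x y → f x ≡ f y → proj₁ x ≡ proj₁ y) ×
      (∀ x y → Edge (proj₁ x) (proj₁ y) ⇔ Edge (f x) (f y)) ×
      (∀ x y → Edge (proj₁ x) (proj₁ y) → w (proj₁ x) (proj₁ y) ≡ w (f x) (f y))

module Submission where

open import Defs
open import Level using (Level)
open import Data.Nat using (ℕ)
open import Data.Fin using (Fin; _<_)
open import Data.Product using (_×_)
open import Relation.Nullary using (¬_)

import Data.Nat as ℕ
import Data.Nat.Properties as ℕ
open import Data.Fin using (zero; suc; toℕ; fromℕ<; _≤_)
open import Data.Fin.Properties using (toℕ-injective; toℕ-fromℕ<; toℕ-inject₁; toℕ<n)
open import Data.Product using (Σ; _,_; proj₁)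
open import Relation.Binary.PropositionalEquality
open import Relation.Binary.Construct.Closure.ReflexiveTransitive using (ε; _◅_; _◅◅_; reverse)
open import Function using (_∘′_)
open import Function.Bundles using (mk⇔)

-- Translating a component C by M(D) − M(C) keeps it inside [n] and preserves all
-- distances |i − j|, hence all edges and weights of the Toeplitz graph. The image
-- is connected and contains M(D), so it lies in D. This works for any pair with
-- M(C) < M(D).

toℕ-dist : ∀ {n} (i j : Fin n) → toℕ (dist i j) ≡ ℕ.∣ toℕ i - toℕ j ∣
toℕ-dist zero    zero    = refl
toℕ-dist zero    (suc j) = refl
toℕ-dist (suc i) zero    = refl
toℕ-dist (suc i) (suc j) = trans (toℕ-inject₁ (dist i j)) (toℕ-dist i j)

dist-comm : ∀ {n} (i j : Fin n) → dist i j ≡ dist j i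
dist-comm i j = toℕ-injective (begin
  toℕ (dist i j)           ≡⟨ toℕ-dist i j ⟩
  ℕ.∣ toℕ i - toℕ j ∣      ≡⟨ ℕ.∣-∣-comm (toℕ i) (toℕ j) ⟩
  ℕ.∣ toℕ j - toℕ i ∣      ≡⟨ toℕ-dist j i ⟨
  toℕ (dist j i)           ∎)
  where open ≡-Reasoning

module Translation {n : ℕ} {m t : Fin n} (m≤t : m ≤ t) where

  offset : ℕ
  offset = toℕ t ℕ.∸ toℕ m

  offset+m≡t : offset ℕ.+ toℕ m ≡ toℕ t
  offset+m≡t = ℕ.m∸n+n≡m m≤t

  translate : (x : Fin n) → .(x ≤ m) → Fin n
  translate x x≤m = fromℕ< (begin-strict
    offset ℕ.+ toℕ x  ≤⟨ ℕ.+-monoʳ-≤ offset x≤m ⟩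
    offset ℕ.+ toℕ m  ≡⟨ offset+m≡t ⟩
    toℕ t             <⟨ toℕ<n t ⟩
    n                 ∎)
    where open ℕ.≤-Reasoning

  toℕ-translate : ∀ x .(x≤m : x ≤ m) → toℕ (translate x x≤m) ≡ offset ℕ.+ toℕ x
  toℕ-translate x x≤m = toℕ-fromℕ< _

  translate-m : translate m ℕ.≤-refl ≡ t
  translate-m = toℕ-injective (trans (toℕ-translate m ℕ.≤-refl) offset+m≡t)

  translate-injective : ∀ x y .(x≤m : x ≤ m) .(y≤m : y ≤ m) →
                        translate x x≤m ≡ translate y y≤m → x ≡ y
  translate-injective x y x≤m y≤m eq = toℕ-injective (ℕ.+-cancelˡ-≡ offset _ _ (begin
    offset ℕ.+ toℕ x        ≡⟨ toℕ-translate x x≤m ⟨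
    toℕ (translate x x≤m)   ≡⟨ cong toℕ eq ⟩
    toℕ (translate y y≤m)   ≡⟨ toℕ-translate y y≤m ⟩
    offset ℕ.+ toℕ y        ∎))
    where open ≡-Reasoning

  dist-translate : ∀ x y .(x≤m : x ≤ m) .(y≤m : y ≤ m) →
                   dist (translate x x≤m) (translate y y≤m) ≡ dist x y
  dist-translate x y x≤m y≤m = toℕ-injective (begin
    toℕ (dist (translate x x≤m) (translate y y≤m))
      ≡⟨ toℕ-dist (translate x x≤m) (translate y y≤m) ⟩
    ℕ.∣ toℕ (translate x x≤m) - toℕ (translate y y≤m) ∣
      ≡⟨ cong₂ ℕ.∣_-_∣ (toℕ-translate x x≤m) (toℕ-translate y y≤m) ⟩
    ℕ.∣ offset ℕ.+ toℕ x - offset ℕ.+ toℕ y ∣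
      ≡⟨ ℕ.∣m+n-m+o∣≡∣n-o∣ offset (toℕ x) (toℕ y) ⟩
    ℕ.∣ toℕ x - toℕ y ∣
      ≡⟨ toℕ-dist x y ⟨
    toℕ (dist x y) ∎)
    where open ≡-Reasoning

module ToeplitzGraphProperties {r : Level} (R : Set r) (0# : R) {n : ℕ} (a : Fin n → R) where
  open ToeplitzGraph R 0# a

  Edge-resp-dist : ∀ i j k l → dist i j ≡ dist k l → Edge i j → Edge k l
  Edge-resp-dist i j k l ij≡kl e = e ∘′ trans (cong a ij≡kl)

  Edge-sym : ∀ {i j} → Edge i j → Edge j i
  Edge-sym {i} {j} = Edge-resp-dist i j j i (dist-comm i j)

  Comp-step : ∀ {u x y} → Comp u x → Edge x y → Comp u y
  Comp-step ux e = ux ◅◅ (e ◅ ε)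

  Comp-connected : ∀ {u x y} → Comp u x → Comp u y → Reach x y
  Comp-connected ux uy = reverse (λ {i} {j} → Edge-sym {i} {j}) ux ◅◅ uy

  ≤-max : ∀ {C m x} → IsMax C m → C x → x ≤ m
  ≤-max (_ , maximal) Cx = ℕ.≮⇒≥ (maximal _ Cx)

  -- The map may depend on a membership proof only irrelevantly, so that the
  -- two ends of a walk need no coherence between their membership proofs.
  Reach-isometric : ∀ {u} (f : ∀ x → .(Comp u x) → Fin n) →
    (∀ x y .(ux : Comp u x) .(uy : Comp u y) → dist (f x ux) (f y uy) ≡ dist x y) →
    ∀ {x y} (ux : Comp u x) (xy : Reach x y) → Reach (f x ux) (f y (ux ◅◅ xy))
  Reach-isometric f f-dist ux ε = ε
  Reach-isometric f f-dist {x} ux (_◅_ {j = y} e yz) =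
    Edge-resp-dist x y (f x ux) (f y (Comp-step ux e)) (sym (f-dist x y ux (Comp-step ux e))) e
    ◅ Reach-isometric f f-dist (Comp-step ux e) yz

  Embeds-isometric : ∀ {C D} (f : Σ (Fin n) C → Fin n) →
    (∀ x → D (f x)) →
    (∀ x y → f x ≡ f y → proj₁ x ≡ proj₁ y) →
    (∀ x y → dist (f x) (f y) ≡ dist (proj₁ x) (proj₁ y)) →
    Embeds C D
  Embeds-isometric f f∈D f-injective f-dist =
    f , f∈D , f-injective ,
    (λ x y → mk⇔ (Edge-resp-dist (proj₁ x) (proj₁ y) (f x) (f y) (sym (f-dist x y)))
                 (Edge-resp-dist (f x) (f y) (proj₁ x) (proj₁ y) (f-dist x y))) ,
    (λ x y _ → cong a (sym (f-dist x y)))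

  Embeds-below-max : ∀ {u v mu mv} → IsMax (Comp u) mu → IsMax (Comp v) mv →
                     mu ≤ mv → Embeds (Comp u) (Comp v)
  Embeds-below-max {u} {v} {mu} {mv} u-max v-max mu≤mv =
    Embeds-isometric {D = Comp v} f f∈Comp-v
      (λ (x , ux) (y , uy) → translate-injective x y (≤-max u-max ux) (≤-max u-max uy))
      (λ (x , ux) (y , uy) → shift-dist x y ux uy)
    where
      open Translation mu≤mv

      shift : ∀ x → .(Comp u x) → Fin n
      shift x ux = translate x (≤-max u-max ux)

      shift-dist : ∀ x y .(ux : Comp u x) .(uy : Comp u y) → dist (shift x ux) (shift y uy) ≡ dist x y
      shift-dist x y ux uy = dist-translate x y (≤-max u-max ux) (≤-max u-max uy)

      f : Σ (Fin n) (Comp u) → Fin n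
      f (x , ux) = shift x ux

      f∈Comp-v : ∀ x → Comp v (f x)
      f∈Comp-v (x , ux) = proj₁ v-max ◅◅ subst (λ m → Reach m (f (x , ux))) translate-m
        (Reach-isometric shift shift-dist (proj₁ u-max) (Comp-connected (proj₁ u-max) ux))

theorem3p4 : ∀ {r : Level} (R : Set r) (0# : R) (n : ℕ) (a : Fin n → R) →
    let open ToeplitzGraph R 0# a in
    ∀ (u v mu mv : Fin n) →
    IsMax (Comp u) mu → IsMax (Comp v) mv → mu < mv →
    (∀ (z mz : Fin n) → IsMax (Comp z) mz → ¬ (mu < mz × mz < mv)) →
    Embeds (Comp u) (Comp v)
theorem3p4 R 0# n a u v mu mv u-max v-max mu<mv _ =
  Embeds-below-max u-max v-max (ℕ.<⇒≤ mu<mv)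
  where open ToeplitzGraphProperties R 0# a
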